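{- Let $T$ be a decomposition tree and $v$ an internal node of $T$ labeled $\odot$, with left child $v_l$ and right child $v_r$. Then $\hat\beta(v)=\hat\beta(v_l)+\hat\beta(v_r)$.
   Context: All graphs are finite, simple and undirected. For a graph $H$ and $S\subseteq V(H)$, $N_H[S]$ is the closed neighbourhood of $S$ in $H$ and $H[S]$ the induced subgraph; a graph with no vertices is regarded as having a (empty) perfect matching. A decomposition tree is a rooted tree $T$ in which every internal node has exactly two children, a left child $v_l$ and a right child $v_r$, and carries one of the labels $\otimes$ (true twin), $\odot$ (false twin), $\oplus$ (attachment). To each node $v$ are associated a graph $\hat G(v)$ and a twin set $\hat{TS}(v)\subseteq V(\hat G(v))$: for a leaf, $\hat G(v)$ is a single vertex $x$ (distinct leaves giving distinct vertices) and $\hat{TS}(v)=\{x\}$; for an internal node $v$, $V(\hat G(v))=V(\hat G(v_l))\cup V(\hat G(v_r))$ and: if $v$ is labeled $\otimes$, $E(\hat G(v))=E(\hat G(v_l))\cup E(\hat G(v_r))\cup\{xy: x\in \hat{TS}(v_l), y\in\hat{TS}(v_r)\}$ and $\hat{TS}(v)=\hat{TS}(v_l)\cup\hat{TS}(v_r)$; if labeled $\odot$, $E(\hat G(v))=E(\hat G(v_l))\cup E(\hat G(v_r))$ and $\hat{TS}(v)=\hat{TS}(v_l)\cup\hat{TS}(v_r)$; if labeled $\oplus$, the edge set is as for $\otimes$ and $\hat{TS}(v)=\hat{TS}(v_l)$. For a node $u$ and $0\le k\le|\hat{TS}(u)|$, $\hat\gamma_k(u)$ is the minimum of $|S|$ over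 all $S\subseteq V(\hat G(u))$ with $V(\hat G(u))\setminus \hat{TS}(u)\subseteq N_{\hat G(u)}[S]$ for which there is $X\subseteq S\cap\hat{TS}(u)$, $|X|=k$, such that $\hat G(u)[S\setminus X]$ has a perfect matching. Let $\widehat{\min}(u)=\min\{\hat\gamma_k(u):0\le k\le|\hat{TS}(u)|\}$ and let $\hat\beta(u)$ be the largest $k$ with $\hat\gamma_k(u)=\widehat{\min}(u)$. -}

module Defs where

open import Data.Nat using (ℕ; zero; suc; _+_; _≤_; _<_)
open import Data.Bool using (Bool; true; false; _∨_; _∧_)
open import Data.Fin using (Fin; splitAt)
open import Data.Fin.Subset using (Subset; _∈_; _∉_; _⊆_; ∣_∣; ⊥; ⁅_⁆)
open import Data.Vec using (_++_)
open import Data.Sum using (_⊎_; inj₁; inj₂)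
open import Data.Product using (Σ; _×_; ∃; _,_)
open import Relation.Binary.PropositionalEquality using (_≡_; _≢_)
open import Relation.Nullary using (¬_)

-- Node labels: ⊗ (true twin), ⊙ (false twin), ⊕ (attachment).
data Label : Set where
  ⊗ ⊙ ⊕ : Label

-- The vertices of Ĝ(t) are the leaves,
-- represented by Fin n: for a node with children having m and k leaves, the
-- left child's vertices are the first m (via splitAt m), the right child's the
-- remaining k.
data DTree : ℕ → Set where
  leaf : DTree 1
  node : {m k : ℕ} → Label → DTree m → DTree k → DTree (m + k)

TS : {n : ℕ} → DTree n → Subset n
TS leaf = ⁅ Fin.zero ⁆
TS (node ⊗ l r) = TS l ++ TS r
TS (node ⊙ l r) = TS l ++ TS r
TS (node ⊕ l r) = TS l ++ ⊥

memb : {n : ℕ} → Subset n → Fin n → Bool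
memb p i = Data.Vec.lookup p i
  where import Data.Vec

joins : Label → Bool
joins ⊗ = true
joins ⊙ = false
joins ⊕ = true

mutual
  adj : {n : ℕ} → DTree n → Fin n → Fin n → Bool
  adj leaf _ _ = false
  adj (node {m} lab l r) i j = adj′ lab l r (splitAt m i) (splitAt m j)

  adj′ : {m k : ℕ} → Label → DTree m → DTree k →
         Fin m ⊎ Fin k → Fin m ⊎ Fin k → Bool
  adj′ lab l r (inj₁ a) (inj₁ b) = adj l a b
  adj′ lab l r (inj₂ a) (inj₂ b) = adj r a b
  adj′ lab l r (inj₁ a) (inj₂ b) = joins lab ∧ memb (TS l) a ∧ memb (TS r) b
  adj′ lab l r (inj₂ a) (inj₁ b) = joins lab ∧ memb (TS l) b ∧ memb (TS r) a

Dominates : {n : ℕ} → DTree n → Subset n → Set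
Dominates t S = ∀ x → x ∉ TS t → Σ _ λ y → y ∈ S × (y ≡ x ⊎ adj t y x ≡ true)

-- The induced subgraph Ĝ(t)[S ∖ X] has a perfect matching: a fixed-point-free
-- involution on S ∖ X mapping every vertex to a neighbour.
HasPerfectMatching : {n : ℕ} → DTree n → Subset n → Subset n → Set
HasPerfectMatching t S X =
  Σ (Fin _ → Fin _) λ p →
    ∀ x → x ∈ S → x ∉ X →
      (p x ∈ S) × (p x ∉ X) × (p x ≢ x) × (p (p x) ≡ x) × (adj t x (p x) ≡ true)

Feasible : {n : ℕ} → DTree n → ℕ → ℕ → Set
Feasible t k s =
  Σ _ λ S → ∣ S ∣ ≡ s × Dominates t S ×
    (Σ _ λ X → X ⊆ S × X ⊆ TS t × ∣ X ∣ ≡ k × HasPerfectMatching t S X)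

IsGamma : {n : ℕ} → DTree n → ℕ → ℕ → Set
IsGamma t k s = k ≤ ∣ TS t ∣ × Feasible t k s × (∀ s′ → Feasible t k s′ → s ≤ s′)

IsMin : {n : ℕ} → DTree n → ℕ → Set
IsMin t m = (Σ ℕ λ k → IsGamma t k m) ×
            (∀ k s → k ≤ ∣ TS t ∣ → IsGamma t k s → m ≤ s)

IsBeta : {n : ℕ} → DTree n → ℕ → Set
IsBeta t b = Σ ℕ λ m → IsMin t m × IsGamma t b m ×
             (∀ k → b < k → k ≤ ∣ TS t ∣ → ¬ IsGamma t k m)

{-# OPTIONS --safe #-}
-- For a ⊙ node no edge joins the two children, so Ĝ(v) is the disjoint union of Ĝ(v_l) and
-- Ĝ(v_r), and TŜ(v) = TŜ(v_l) ∪ TŜ(v_r).  Dominating sets, the sets X and the perfect matchings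
-- of S ∖ X all split along the two components and glue back together, so the feasible pairs
-- (k, |S|) of v are exactly the sums of feasible pairs of v_l and v_r.  Hence the least size for
-- v is the sum of the least sizes of the children, every least-size witness for v consists of
-- least-size witnesses for both children, and the largest k realised at that size is additive.

module Submission where

open import Defs
open import Data.Nat using (ℕ; suc; _+_; _≤_; _<_; _<?_; _≤?_)
open import Data.Nat.Properties
  using ( ≤-antisym; ≤-trans; ≤-reflexive; <⇒≤; ≰⇒>; ≤⇒≯; ≮⇒≥
        ; +-mono-≤; +-monoʳ-≤; +-cancelʳ-≤; +-cancelˡ-≡)
open import Data.Nat.Induction using (<-rec)
open import Data.Bool using (true; false)
open import Data.Fin using (Fin; splitAt; join; _↑ˡ_; _↑ʳ_)
open import Data.Fin.Properties using (splitAt-↑ˡ; splitAt-↑ʳ; splitAt⁻¹-↑ˡ; splitAt⁻¹-↑ʳ)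
open import Data.Fin.Subset using (Subset; _∈_; _∉_; _⊆_; ∣_∣; inside; outside)
open import Data.Fin.Subset.Properties using (p⊆q⇒∣p∣≤∣q∣)
open import Data.Vec using ([]; _∷_; _++_; lookup)
import Data.Vec as Vec
open import Data.Vec.Properties using (lookup-++ˡ; lookup-++ʳ; []=⇒lookup; lookup⇒[]=)
open import Data.Sum using (_⊎_; inj₁; inj₂; [_,_]′)
import Data.Sum as Sum
open import Data.Product using (Σ; _×_; ∃; _,_)
open import Function using (_∘_; id; const)
open import Function.Bundles using (_⇔_; mk⇔; Equivalence)
open import Relation.Binary.PropositionalEquality
open import Relation.Nullary using (¬_; yes; no; contradiction)

open Equivalence using (to; from)
open ≡-Reasoning

bounds-all⇐bounds-least : ∀ {ℓ} (P : ℕ → Set ℓ) {b} →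
                          (∀ s → P s → (∀ s′ → P s′ → s ≤ s′) → b ≤ s) → ∀ s → P s → b ≤ s
bounds-all⇐bounds-least P {b} bounds-least = <-rec (λ s → P s → b ≤ s) step
  where
  step : ∀ s → (∀ {s′} → s′ < s → P s′ → b ≤ s′) → P s → b ≤ s
  step s ih Ps with b ≤? s
  ... | yes b≤s = b≤s
  ... | no b≰s  = contradiction (bounds-least s Ps least) b≰s
    where
    least : ∀ s′ → P s′ → s ≤ s′
    least s′ Ps′ with s ≤? s′
    ... | yes s≤s′ = s≤s′
    ... | no s≰s′  = contradiction (≤-trans (ih s′<s Ps′) (<⇒≤ s′<s)) b≰s
      where
      s′<s : s′ < s
      s′<s = ≰⇒> s≰s′

m+n≡o+p⇒m≡o×n≡p : ∀ {m n o p} → m ≤ o → n ≤ p → m + n ≡ o + p → m ≡ o × n ≡ p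
m+n≡o+p⇒m≡o×n≡p {m} {n} {o} {p} m≤o n≤p eq =
  m≡o , +-cancelˡ-≡ o n p (trans (cong (_+ n) (sym m≡o)) eq)
  where
  m≡o : m ≡ o
  m≡o = ≤-antisym m≤o (+-cancelʳ-≤ n o m (≤-trans (+-monoʳ-≤ o n≤p) (≤-reflexive (sym eq))))

m+n<o+p⇒m<o⊎n<p : ∀ {m n o p} → m + n < o + p → m < o ⊎ n < p
m+n<o+p⇒m<o⊎n<p {m} {n} {o} {p} m+n<o+p with m <? o | n <? p
... | yes m<o | _       = inj₁ m<o
... | no _    | yes n<p = inj₂ n<p
... | no m≮o  | no n≮p  = contradiction m+n<o+p (≤⇒≯ (+-mono-≤ (≮⇒≥ m≮o) (≮⇒≥ n≮p)))

data Side (m : ℕ) {k : ℕ} : Fin (m + k) → Set where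
  left  : (a : Fin m) → Side m (a ↑ˡ k)
  right : (b : Fin k) → Side m (m ↑ʳ b)

side : ∀ m {k} (x : Fin (m + k)) → Side m x
side m x with splitAt m x in eq
... | inj₁ a = subst (Side m) (splitAt⁻¹-↑ˡ eq) (left a)
... | inj₂ b = subst (Side m) (splitAt⁻¹-↑ʳ eq) (right b)

∈-transport : ∀ {m n} {p : Subset m} {q : Subset n} {x y} →
              lookup p x ≡ lookup q y → x ∈ p ⇔ y ∈ q
∈-transport {p = p} {q} {x} {y} eq =
  mk⇔ (λ x∈p → lookup⇒[]= y q (trans (sym eq) ([]=⇒lookup x∈p)))
      (λ y∈q → lookup⇒[]= x p (trans eq ([]=⇒lookup y∈q)))

Restricts : ∀ {m n} → (Fin m → Fin n) → Subset n → Subset m → Set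
Restricts ι S S′ = ∀ a → ι a ∈ S ⇔ a ∈ S′

restricts-++ˡ : ∀ {m k} (p : Subset m) (q : Subset k) → Restricts (_↑ˡ k) (p ++ q) p
restricts-++ˡ p q a = ∈-transport (lookup-++ˡ p q a)

restricts-++ʳ : ∀ {m k} (p : Subset m) (q : Subset k) → Restricts (m ↑ʳ_) (p ++ q) q
restricts-++ʳ p q b = ∈-transport (lookup-++ʳ p q b)

⊆-restrict : ∀ {m n} {ι : Fin m → Fin n} {X S X′ S′} →
             Restricts ι X X′ → Restricts ι S S′ → X ⊆ S → X′ ⊆ S′
⊆-restrict rX rS X⊆S {a} a∈X′ = to (rS a) (X⊆S (from (rX a) a∈X′))

⊆-++ : ∀ {m k} {X S : Subset m} {X′ S′ : Subset k} → X ⊆ S → X′ ⊆ S′ → X ++ X′ ⊆ S ++ S′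
⊆-++ {m} {X = X} {S} {X′} {S′} X⊆S X′⊆S′ {x} with side m x
... | left a  = from (restricts-++ˡ S S′ a) ∘ X⊆S ∘ to (restricts-++ˡ X X′ a)
... | right b = from (restricts-++ʳ S S′ b) ∘ X′⊆S′ ∘ to (restricts-++ʳ X X′ b)

∣p++q∣≡∣p∣+∣q∣ : ∀ {m k} (p : Subset m) (q : Subset k) → ∣ p ++ q ∣ ≡ ∣ p ∣ + ∣ q ∣
∣p++q∣≡∣p∣+∣q∣ []            q = refl
∣p++q∣≡∣p∣+∣q∣ (outside ∷ p) q = ∣p++q∣≡∣p∣+∣q∣ p q
∣p++q∣≡∣p∣+∣q∣ (inside  ∷ p) q = cong suc (∣p++q∣≡∣p∣+∣q∣ p q)

adj-sym : ∀ {n} (t : DTree n) x y → adj t x y ≡ adj t y x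
adj-sym leaf _ _ = refl
adj-sym (node {m} lab l r) x y = adj′-sym (splitAt m x) (splitAt m y)
  where
  adj′-sym : ∀ u w → adj′ lab l r u w ≡ adj′ lab l r w u
  adj′-sym (inj₁ a) (inj₁ b) = adj-sym l a b
  adj′-sym (inj₁ a) (inj₂ b) = refl
  adj′-sym (inj₂ a) (inj₁ b) = refl
  adj′-sym (inj₂ a) (inj₂ b) = adj-sym r a b

DominatedBy : ∀ {n} → DTree n → Subset n → Fin n → Set
DominatedBy t S x = Σ _ λ y → y ∈ S × (y ≡ x ⊎ adj t y x ≡ true)

MatchedBy : ∀ {n} → DTree n → Subset n → Subset n → (Fin n → Fin n) → Fin n → Set
MatchedBy t S X p x =
  (p x ∈ S) × (p x ∉ X) × (p x ≢ x) × (p (p x) ≡ x) × (adj t x (p x) ≡ true)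

-- Ĝ(c) sits inside Ĝ(t) as a union of connected components.  `project d y` recovers
-- the preimage of y; the default d is returned when y is not in the image.
record ComponentEmbedding {m n} (c : DTree m) (t : DTree n) : Set where
  field
    embed         : Fin m → Fin n
    project       : Fin m → Fin n → Fin m
    project-embed : ∀ d a → project d (embed a) ≡ a
    adj-embed     : ∀ a b → adj t (embed a) (embed b) ≡ adj c a b
    adj-closed    : ∀ a y → adj t (embed a) y ≡ true → embed (project a y) ≡ y
    TS-restricts  : Restricts embed (TS t) (TS c)

  embed-injective : ∀ {a b} → embed a ≡ embed b → a ≡ b
  embed-injective {a} {b} eq = begin
    a                   ≡⟨ project-embed a a ⟨
    project a (embed a) ≡⟨ cong (project a) eq ⟩
    project a (embed b) ≡⟨ project-embed a b ⟩
    b                   ∎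

  Dominates-restrict : ∀ {S S′} → Restricts embed S S′ → Dominates t S → Dominates c S′
  Dominates-restrict {S} rS D a a∉TS with D (embed a) (a∉TS ∘ to (TS-restricts a))
  ... | y , y∈S , inj₁ y≡ = a , to (rS a) (subst (_∈ S) y≡ y∈S) , inj₁ refl
  ... | y , y∈S , inj₂ y~ =
    project a y , to (rS _) (subst (_∈ S) (sym e) y∈S) ,
    inj₂ (trans (sym (adj-embed _ a)) (subst (λ z → adj t z (embed a) ≡ true) (sym e) y~))
    where
    e : embed (project a y) ≡ y
    e = adj-closed a y (trans (adj-sym t (embed a) y) y~)

  dominatedBy-embed : ∀ {S S′} → Restricts embed S S′ → Dominates c S′ →
                      ∀ a → embed a ∉ TS t → DominatedBy t S (embed a)
  dominatedBy-embed rS D a a∉TS with D a (a∉TS ∘ from (TS-restricts a))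
  ... | b , b∈S′ , inj₁ b≡a = embed b , from (rS b) b∈S′ , inj₁ (cong embed b≡a)
  ... | b , b∈S′ , inj₂ b~a = embed b , from (rS b) b∈S′ , inj₂ (trans (adj-embed b a) b~a)

  HasPerfectMatching-restrict : ∀ {S S′ X X′} → Restricts embed S S′ → Restricts embed X X′ →
                                HasPerfectMatching t S X → HasPerfectMatching c S′ X′
  HasPerfectMatching-restrict {S} {S′} {X} {X′} rS rX (p , matched) = p′ , matched′
    where
    p′ : Fin m → Fin m
    p′ a = project a (p (embed a))

    restrict : ∀ a → MatchedBy t S X p (embed a) → MatchedBy c S′ X′ p′ a
    restrict a (px∈S , px∉X , px≢x , ppx≡x , x~px) =
      to (rS _) (subst (_∈ S) (sym e) px∈S) ,
      px∉X ∘ subst (_∈ X) e ∘ from (rX _) ,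
      (λ p′a≡a → px≢x (trans (sym e) (cong embed p′a≡a))) ,
      (begin
        project (p′ a) (p (embed (p′ a))) ≡⟨ cong (project (p′ a) ∘ p) e ⟩
        project (p′ a) (p (p (embed a)))  ≡⟨ cong (project (p′ a)) ppx≡x ⟩
        project (p′ a) (embed a)          ≡⟨ project-embed (p′ a) a ⟩
        a                                 ∎) ,
      trans (sym (adj-embed a (p′ a))) (subst (λ z → adj t (embed a) z ≡ true) (sym e) x~px)
      where
      e : embed (p′ a) ≡ p (embed a)
      e = adj-closed a (p (embed a)) x~px

    matched′ : ∀ a → a ∈ S′ → a ∉ X′ → MatchedBy c S′ X′ p′ a
    matched′ a a∈S′ a∉X′ = restrict a (matched (embed a) (from (rS a) a∈S′) (a∉X′ ∘ to (rX a)))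

  matchedBy-embed : ∀ {S S′ X X′ p p′} → Restricts embed S S′ → Restricts embed X X′ →
                    (∀ a → p (embed a) ≡ embed (p′ a)) →
                    (∀ a → a ∈ S′ → a ∉ X′ → MatchedBy c S′ X′ p′ a) →
                    ∀ a → embed a ∈ S → embed a ∉ X → MatchedBy t S X p (embed a)
  matchedBy-embed {S} {S′} {X} {X′} {p} {p′} rS rX commute matched a x∈S x∉X
    with matched a (to (rS a) x∈S) (x∉X ∘ from (rX a))
  ... | p′a∈S′ , p′a∉X′ , p′a≢a , p′p′a≡a , a~p′a =
    subst (_∈ S) (sym (commute a)) (from (rS _) p′a∈S′) ,
    p′a∉X′ ∘ to (rX _) ∘ subst (_∈ X) (commute a) ,
    p′a≢a ∘ embed-injective ∘ trans (sym (commute a)) ,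
    (begin
      p (p (embed a))      ≡⟨ cong p (commute a) ⟩
      p (embed (p′ a))     ≡⟨ commute (p′ a) ⟩
      embed (p′ (p′ a))    ≡⟨ cong embed p′p′a≡a ⟩
      embed a              ∎) ,
    trans (cong (adj t (embed a)) (commute a)) (trans (adj-embed a (p′ a)) a~p′a)

  Feasible-restrict : ∀ {S X S′ X′} → Restricts embed S S′ → Restricts embed X X′ →
                      Dominates t S → X ⊆ S → X ⊆ TS t → HasPerfectMatching t S X →
                      Feasible c ∣ X′ ∣ ∣ S′ ∣
  Feasible-restrict {S′ = S′} {X′} rS rX D X⊆S X⊆TS M =
    S′ , refl , Dominates-restrict rS D ,
    X′ , ⊆-restrict rX rS X⊆S , ⊆-restrict rX TS-restricts X⊆TS , refl ,
    HasPerfectMatching-restrict rS rX M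

module _ {n : ℕ} (t : DTree n) where

  IsLeastSize : ℕ → Set
  IsLeastSize s = ∀ i s′ → Feasible t i s′ → s ≤ s′

  -- Unlike IsMin, which only compares exact values γ̂_k, this compares with every feasible size.
  IsLargestOptimalK : ℕ → ℕ → Set
  IsLargestOptimalK b s = Feasible t b s × IsLeastSize s × (∀ i → b < i → ¬ Feasible t i s)

  Feasible⇒≤∣TS∣ : ∀ {i s} → Feasible t i s → i ≤ ∣ TS t ∣
  Feasible⇒≤∣TS∣ (_ , _ , _ , _ , _ , X⊆TS , refl , _) = p⊆q⇒∣p∣≤∣q∣ X⊆TS

  IsMin⇒IsLeastSize : ∀ {s} → IsMin t s → IsLeastSize s
  IsMin⇒IsLeastSize (_ , min≤γ) i = bounds-all⇐bounds-least (Feasible t i)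
    λ s F least → min≤γ i s (Feasible⇒≤∣TS∣ F) (Feasible⇒≤∣TS∣ F , F , least)

  IsLeastSize⇒IsGamma : ∀ {i s} → Feasible t i s → IsLeastSize s → IsGamma t i s
  IsLeastSize⇒IsGamma F least = Feasible⇒≤∣TS∣ F , F , least _

  IsBeta⇒IsLargestOptimalK : ∀ {b} → IsBeta t b → Σ ℕ (IsLargestOptimalK b)
  IsBeta⇒IsLargestOptimalK (s , min , (_ , F , _) , largest) =
    s , F , least , λ i b<i F′ → largest i b<i (Feasible⇒≤∣TS∣ F′) (IsLeastSize⇒IsGamma F′ least)
    where
    least : IsLeastSize s
    least = IsMin⇒IsLeastSize min

  IsLargestOptimalK⇒IsBeta : ∀ {b s} → IsLargestOptimalK b s → IsBeta t b
  IsLargestOptimalK⇒IsBeta {b} {s} (F , least , largest) =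
    s , isMin , IsLeastSize⇒IsGamma F least , λ { i b<i _ (_ , F′ , _) → largest i b<i F′ }
    where
    isMin : IsMin t s
    isMin = (b , IsLeastSize⇒IsGamma F least) , λ { i s′ _ (_ , F′ , _) → least i s′ F′ }

module FalseTwin {m k : ℕ} (l : DTree m) (r : DTree k) where

  no-cross-edge : ∀ a b → adj (node ⊙ l r) (a ↑ˡ k) (m ↑ʳ b) ≡ false
  no-cross-edge a b = cong₂ (adj′ ⊙ l r) (splitAt-↑ˡ m a k) (splitAt-↑ʳ m k b)

  leftComponent : ComponentEmbedding l (node ⊙ l r)
  leftComponent = record
    { embed         = _↑ˡ k
    ; project       = project
    ; project-embed = λ d a → cong [ id , const d ]′ (splitAt-↑ˡ m a k)
    ; adj-embed     = λ a b → cong₂ (adj′ ⊙ l r) (splitAt-↑ˡ m a k) (splitAt-↑ˡ m b k)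
    ; adj-closed    = closed
    ; TS-restricts  = restricts-++ˡ (TS l) (TS r)
    }
    where
    project : Fin m → Fin (m + k) → Fin m
    project d y = [ id , const d ]′ (splitAt m y)

    closed : ∀ a y → adj (node ⊙ l r) (a ↑ˡ k) y ≡ true → project a y ↑ˡ k ≡ y
    closed a y a~y with side m y
    ... | left b  = cong (λ z → [ id , const a ]′ z ↑ˡ k) (splitAt-↑ˡ m b k)
    ... | right b = contradiction (trans (sym (no-cross-edge a b)) a~y) λ ()

  rightComponent : ComponentEmbedding r (node ⊙ l r)
  rightComponent = record
    { embed         = m ↑ʳ_
    ; project       = project
    ; project-embed = λ d b → cong [ const d , id ]′ (splitAt-↑ʳ m k b)
    ; adj-embed     = λ a b → cong₂ (adj′ ⊙ l r) (splitAt-↑ʳ m k a) (splitAt-↑ʳ m k b)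
    ; adj-closed    = closed
    ; TS-restricts  = restricts-++ʳ (TS l) (TS r)
    }
    where
    project : Fin k → Fin (m + k) → Fin k
    project d y = [ const d , id ]′ (splitAt m y)

    closed : ∀ b y → adj (node ⊙ l r) (m ↑ʳ b) y ≡ true → m ↑ʳ project b y ≡ y
    closed b y b~y with side m y
    ... | right c = cong (λ z → m ↑ʳ [ const b , id ]′ z) (splitAt-↑ʳ m k c)
    ... | left a  = contradiction
      (trans (sym (no-cross-edge a b)) (trans (adj-sym (node ⊙ l r) _ _) b~y)) λ ()

  module L = ComponentEmbedding leftComponent
  module R = ComponentEmbedding rightComponent

  Dominates-++ : ∀ {S S′} → Dominates l S → Dominates r S′ → Dominates (node ⊙ l r) (S ++ S′)
  Dominates-++ {S} {S′} D D′ x with side m x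
  ... | left a  = L.dominatedBy-embed (restricts-++ˡ S S′) D a
  ... | right b = R.dominatedBy-embed (restricts-++ʳ S S′) D′ b

  HasPerfectMatching-++ : ∀ {S S′ X X′} → HasPerfectMatching l S X → HasPerfectMatching r S′ X′ →
                          HasPerfectMatching (node ⊙ l r) (S ++ S′) (X ++ X′)
  HasPerfectMatching-++ {S} {S′} {X} {X′} (p , matched) (p′ , matched′) = q , matchedq
    where
    q : Fin (m + k) → Fin (m + k)
    q = join m k ∘ Sum.map p p′ ∘ splitAt m

    matchedq : ∀ x → x ∈ S ++ S′ → x ∉ X ++ X′ → MatchedBy (node ⊙ l r) (S ++ S′) (X ++ X′) q x
    matchedq x with side m x
    ... | left a  = L.matchedBy-embed {p = q} (restricts-++ˡ S S′) (restricts-++ˡ X X′)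
                      (λ a → cong (join m k ∘ Sum.map p p′) (splitAt-↑ˡ m a k)) matched a
    ... | right b = R.matchedBy-embed {p = q} (restricts-++ʳ S S′) (restricts-++ʳ X X′)
                      (λ b → cong (join m k ∘ Sum.map p p′) (splitAt-↑ʳ m k b)) matched′ b

  Feasible-++ : ∀ {i j s s′} → Feasible l i s → Feasible r j s′ →
                Feasible (node ⊙ l r) (i + j) (s + s′)
  Feasible-++ (S  , refl , D  , X  , X⊆S   , X⊆TS  , refl , M)
              (S′ , refl , D′ , X′ , X′⊆S′ , X′⊆TS , refl , M′) =
    S ++ S′ , ∣p++q∣≡∣p∣+∣q∣ S S′ , Dominates-++ D D′ ,
    X ++ X′ , ⊆-++ X⊆S X′⊆S′ , ⊆-++ X⊆TS X′⊆TS , ∣p++q∣≡∣p∣+∣q∣ X X′ ,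
    HasPerfectMatching-++ M M′

  Feasible-split : ∀ {i s} → Feasible (node ⊙ l r) i s →
                   ∃ λ i₁ → ∃ λ i₂ → ∃ λ s₁ → ∃ λ s₂ → i ≡ i₁ + i₂ × s ≡ s₁ + s₂ ×
                   Feasible l i₁ s₁ × Feasible r i₂ s₂
  Feasible-split (S , refl , D , X , X⊆S , X⊆TS , refl , M) with Vec.splitAt m S | Vec.splitAt m X
  ... | Sˡ , Sʳ , refl | Xˡ , Xʳ , refl =
    ∣ Xˡ ∣ , ∣ Xʳ ∣ , ∣ Sˡ ∣ , ∣ Sʳ ∣ , ∣p++q∣≡∣p∣+∣q∣ Xˡ Xʳ , ∣p++q∣≡∣p∣+∣q∣ Sˡ Sʳ ,
    L.Feasible-restrict (restricts-++ˡ Sˡ Sʳ) (restricts-++ˡ Xˡ Xʳ) D X⊆S X⊆TS M ,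
    R.Feasible-restrict (restricts-++ʳ Sˡ Sʳ) (restricts-++ʳ Xˡ Xʳ) D X⊆S X⊆TS M

  IsLargestOptimalK-⊙ : ∀ {bl br sl sr} → IsLargestOptimalK l bl sl → IsLargestOptimalK r br sr →
                        IsLargestOptimalK (node ⊙ l r) (bl + br) (sl + sr)
  IsLargestOptimalK-⊙ {bl} {br} {sl} {sr} (Fl , leastl , largestl) (Fr , leastr , largestr) =
    Feasible-++ Fl Fr , least , largest
    where
    least : IsLeastSize (node ⊙ l r) (sl + sr)
    least i s F with Feasible-split F
    ... | _ , _ , _ , _ , refl , refl , F₁ , F₂ = +-mono-≤ (leastl _ _ F₁) (leastr _ _ F₂)

    largest : ∀ i → bl + br < i → ¬ Feasible (node ⊙ l r) i (sl + sr)
    largest i b<i F with Feasible-split F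
    ... | i₁ , i₂ , _ , _ , refl , s≡ , F₁ , F₂
      with m+n≡o+p⇒m≡o×n≡p (leastl _ _ F₁) (leastr _ _ F₂) s≡
    ... | refl , refl with m+n<o+p⇒m<o⊎n<p b<i
    ... | inj₁ bl<i₁ = largestl i₁ bl<i₁ F₁
    ... | inj₂ br<i₂ = largestr i₂ br<i₂ F₂

lemma20 : {m k : ℕ} (l : DTree m) (r : DTree k) (bl br : ℕ) →
          IsBeta l bl → IsBeta r br → IsBeta (node ⊙ l r) (bl + br)
lemma20 l r bl br βl βr with IsBeta⇒IsLargestOptimalK l βl | IsBeta⇒IsLargestOptimalK r βr
... | _ , optl | _ , optr = IsLargestOptimalK⇒IsBeta (node ⊙ l r) (IsLargestOptimalK-⊙ optl optr)
  where open FalseTwin l r
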